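{- Let $G$ be a graph. Then there exists a one-to-one correspondence between the set of all smooth travel groupoids on $G$ and the set of all smooth T-partition systems on $G$.
   Context: Graphs are undirected, possibly infinite, with no loops and no multiple edges; write $G=(V,E)$. A travel groupoid is a nonempty set $V$ with binary operation $*$ satisfying (t1) $(u*v)*u=u$ for all $u,v$ and (t2) if $(u*v)*v=u$ then $u=v$; it is on $G$ if $V(G)=V$ and $E(G)=\{\{u,v\}\mid u\neq v,\ u*v=v\}$; it is smooth if for all $u,v,w$, $u*v=u*w$ implies $u*(v*w)=u*v$. For $u\in V$, $N_G[u]=\{u\}\cup\{v\mid\{u,v\}\in E\}$. A T-partition system on $G$ is a family $(V_{u,v}\subseteq V\mid (u,v)\in V\times V)$ such that: (P0) for every $u$, $\{V_{u,v}\mid v\in N_G[u]\}$ is a partition of $V$; (P1a) $V_{u,u}=\{u\}$; (P1b) for $u\neq v$: $v\in V_{u,v}$ iff $\{u,v\}\in E$; (P1c) for $u\neq v$: $V_{u,v}=\emptyset$ iff $\{u,v\}\notin E$; (P2) for $u\neq v$: $V_{u,v}\cap V_{v,u}=\emptyset$. It is smooth if (R4): for all $u,v,x,y,z\in V$, if $x,y\in V_{u,v}$ and $x\in V_{y,z}$ then $z\in V_{u,v}$. -}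

module Defs where

open import Level using (0ℓ)
open import Data.Product using (Σ; ∃; ∃-syntax; _×_; _,_)
open import Data.Sum using (_⊎_)
open import Relation.Binary.PropositionalEquality using (_≡_; _≢_; refl; sym; trans)
open import Relation.Nullary using (¬_)
open import Relation.Unary using (Pred; _∈_; _∉_)
open import Relation.Binary.Bundles using (Setoid)
open import Function.Bundles using (_⇔_)
import Function.Properties.Equivalence as ⇔

record Graph : Set₁ where
  field
    V        : Set
    E        : V → V → Set
    E-sym    : ∀ {u v} → E u v → E v u
    E-irrefl : ∀ {u} → ¬ E u u
    point    : V

module _ (G : Graph) where
  open Graph G

  N[_] : V → Pred V 0ℓ
  N[ u ] v = v ≡ u ⊎ E u v

  record IsTravelGroupoidOn (_*_ : V → V → V) : Set where
    field
      t1 : ∀ u v → (u * v) * u ≡ u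
      t2 : ∀ u v → (u * v) * v ≡ u → u ≡ v
      -- E(G) = { {u,v} | u ≠ v, u * v = v }  (unordered pairs)
      on : ∀ u v → E u v ⇔ (u ≢ v × (u * v ≡ v ⊎ v * u ≡ u))

  IsSmoothOp : (V → V → V) → Set
  IsSmoothOp _*_ = ∀ u v w → u * v ≡ u * w → u * (v * w) ≡ u * v

  record SmoothTravelGroupoid : Set where
    field
      _*_      : V → V → V
      isTravel : IsTravelGroupoidOn _*_
      smooth   : IsSmoothOp _*_

  SmoothTravelGroupoidSetoid : Setoid 0ℓ 0ℓ
  SmoothTravelGroupoidSetoid = record
    { Carrier = SmoothTravelGroupoid
    ; _≈_ = λ A B → ∀ u v → SmoothTravelGroupoid._*_ A u v ≡ SmoothTravelGroupoid._*_ B u v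
    ; isEquivalence = record
      { refl  = λ u v → refl
      ; sym   = λ p u v → sym (p u v)
      ; trans = λ p q u v → trans (p u v) (q u v) } }

  -- T-partition systems on G;  w ∈ P u v  means  w ∈ V_{u,v}

  -- (P0) for fixed u: {V_{u,v} | v ∈ N[u]} is a partition of V
  -- (indexed by v: blocks nonempty, pairwise disjoint, covering V)
  IsPartitionAt : (V → V → Pred V 0ℓ) → V → Set
  IsPartitionAt P u =
      (∀ v → v ∈ N[ u ] → ∃[ w ] (w ∈ P u v))
    × (∀ v v' w → v ∈ N[ u ] → v' ∈ N[ u ] → w ∈ P u v → w ∈ P u v' → v ≡ v')
    × (∀ w → ∃[ v ] (v ∈ N[ u ] × w ∈ P u v))

  record IsTPartitionSystem (P : V → V → Pred V 0ℓ) : Set where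
    field
      P0  : ∀ u → IsPartitionAt P u
      P1a : ∀ u w → w ∈ P u u ⇔ w ≡ u
      P1b : ∀ u v → u ≢ v → (v ∈ P u v ⇔ E u v)
      P1c : ∀ u v → u ≢ v → ((∀ w → w ∉ P u v) ⇔ (¬ E u v))
      P2  : ∀ u v → u ≢ v → ∀ w → w ∈ P u v → w ∉ P v u

  IsSmoothPartition : (V → V → Pred V 0ℓ) → Set
  IsSmoothPartition P =
    ∀ u v x y z → x ∈ P u v → y ∈ P u v → x ∈ P y z → z ∈ P u v

  record SmoothTPartitionSystem : Set₁ where
    field
      P         : V → V → Pred V 0ℓ
      isTPS     : IsTPartitionSystem P
      smoothR4  : IsSmoothPartition P

  SmoothTPartitionSystemSetoid : Setoid (Level.suc 0ℓ) 0ℓ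
  SmoothTPartitionSystemSetoid = record
    { Carrier = SmoothTPartitionSystem
    ; _≈_ = λ A B → ∀ u v w →
              (w ∈ SmoothTPartitionSystem.P A u v) ⇔ (w ∈ SmoothTPartitionSystem.P B u v)
    ; isEquivalence = record
      { refl  = λ u v w → ⇔.refl
      ; sym   = λ p u v w → ⇔.sym (p u v w)
      ; trans = λ p q u v w → ⇔.trans (p u v w) (q u v w) } }

module Submission where

-- A smooth travel groupoid (V, *) on G and a smooth T-partition system on G
-- determine each other through the single relation
--
--          w ∈ V_{u,v}   ⟺   u * w = v ,
--
-- i.e. V_{u,v} is the set of targets w for which the first step from u
-- towards w is v.
-- Excluded middle is used only to decide, for an abstract vertex v, whether
-- v lies in the closed neighbourhood N[u].

open import Defs
open import Level using (0ℓ)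
open import Axiom.ExcludedMiddle using (ExcludedMiddle)
open import Function.Bundles using (Inverse; mk⇔; Equivalence)
open import Function.Definitions using (Congruent; Inverseˡ; Inverseʳ)
open import Function.Consequences.Setoid
  using (strictlyInverseˡ⇒inverseˡ; strictlyInverseʳ⇒inverseʳ)
open import Data.Product using (∃; _×_; _,_; proj₁; proj₂)
open import Data.Sum using (_⊎_; inj₁; inj₂)
open import Data.Empty using (⊥-elim)
open import Relation.Nullary using (yes; no)
open import Relation.Unary using (Pred; _∈_)
open import Relation.Binary.PropositionalEquality
  using (_≡_; _≢_; refl; sym; trans; cong; subst)
open import Relation.Binary.Bundles using (Setoid)

open Equivalence using (to; from)

module _ (G : Graph) where
  open Graph G

  edge-distinct : ∀ {u v} → E u v → u ≢ v
  edge-distinct e refl = E-irrefl e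

  module TravelGroupoidFacts (_*_ : V → V → V) (T : IsTravelGroupoidOn G _*_) where
    open IsTravelGroupoidOn T

    -- (t1) with v = u gives (u * u) * u = u, and (t2) then forces u * u = u.
    idempotent : ∀ u → u * u ≡ u
    idempotent u = t2 (u * u) u (cong (_* u) (t1 u u))

    step-stays⇒equal : ∀ u w → u * w ≡ u → u ≡ w
    step-stays⇒equal u w e = t2 u w (trans (cong (_* w) e) e)

    -- Along an edge the first step is the neighbour itself (the relation
    -- "u * v = v" is symmetric on edges by (t1)).
    edge⇒step : ∀ u v → E u v → u * v ≡ v
    edge⇒step u v e with to (on u v) e
    ... | _ , inj₁ uv≡v = uv≡v
    ... | _ , inj₂ vu≡u = subst (λ x → x * v ≡ v) vu≡u (t1 v u)

    -- A step that moves, moves along an edge: (t1) says (u * w) * u = u.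
    step-moves⇒edge : ∀ u w → u ≢ u * w → E u (u * w)
    step-moves⇒edge u w ne = from (on u (u * w)) (ne , inj₂ (t1 u w))

    step∈N : ExcludedMiddle 0ℓ → ∀ u w → u * w ∈ N[_] G u
    step∈N em u w with em {u * w ≡ u}
    ... | yes stays = inj₁ stays
    ... | no moves  = inj₂ (step-moves⇒edge u w (λ e → moves (sym e)))

  StepBlocks : (V → V → V) → V → V → Pred V 0ℓ
  StepBlocks _*_ u v w = u * w ≡ v

  stepBlocks-isTPS : ExcludedMiddle 0ℓ → ∀ _*_ → IsTravelGroupoidOn G _*_ →
                     IsTPartitionSystem G (StepBlocks _*_)
  stepBlocks-isTPS em _*_ T = record
    { P0  = λ u → nonempty u , disjoint u , (λ w → u * w , step∈N em u w , refl)
    ; P1a = λ u w → mk⇔ (λ e → sym (step-stays⇒equal u w e))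
                        (λ { refl → idempotent u })
    ; P1b = λ u v u≢v → mk⇔ (λ uv≡v → from (on u v) (u≢v , inj₁ uv≡v)) (edge⇒step u v)
    ; P1c = λ u v u≢v → mk⇔ (λ empty e → empty v (edge⇒step u v e))
                            (λ ¬e w uw≡v → ¬e (non-edge-empty u v w u≢v uw≡v))
    ; P2  = antisymmetric
    }
    where
      open IsTravelGroupoidOn T
      open TravelGroupoidFacts _*_ T

      nonempty : ∀ u v → v ∈ N[_] G u → ∃ λ w → u * w ≡ v
      nonempty u v (inj₁ refl) = u , idempotent u
      nonempty u v (inj₂ e)    = v , edge⇒step u v e

      disjoint : ∀ u v v' w → v ∈ N[_] G u → v' ∈ N[_] G u →
                 u * w ≡ v → u * w ≡ v' → v ≡ v'
      disjoint u v v' w _ _ p q = trans (sym p) q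

      non-edge-empty : ∀ u v w → u ≢ v → u * w ≡ v → E u v
      non-edge-empty u v w u≢v uw≡v =
        subst (E u) uw≡v (step-moves⇒edge u w (λ e → u≢v (trans e uw≡v)))

      -- (P2): w ∈ V_{u,v} ∩ V_{v,u} gives (u * w) * w = u, so u = w by (t2),
      -- and then v = u * u = u.
      antisymmetric : ∀ u v → u ≢ v → ∀ w → u * w ≡ v → v * w ≢ u
      antisymmetric u v u≢v w uw≡v vw≡u = u≢v u≡v
        where
          u≡w : u ≡ w
          u≡w = t2 u w (trans (cong (_* w) uw≡v) vw≡u)
          u≡v : u ≡ v
          u≡v = trans (sym (idempotent u)) (subst (λ x → u * x ≡ v) (sym u≡w) uw≡v)

  -- Smoothness of the operation gives (R4) for its step blocks: from
  -- u * x = u * y = v and y * z = x, smoothness yields u * (y * z) = u * y.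
  stepBlocks-smooth : ∀ _*_ → IsSmoothOp G _*_ → IsSmoothPartition G (StepBlocks _*_)
  stepBlocks-smooth _*_ smooth u v x y z ux≡v uy≡v yz≡x =
    trans (cong (u *_) (sym yz≡x)) (trans (smooth u y x (trans uy≡v (sym ux≡v))) uy≡v)

  -- A T-partition system read as an operation: u * w is the index of the
  -- block of the partition at u that contains w.
  module PartitionOperation (P : V → V → Pred V 0ℓ) (T : IsTPartitionSystem G P) where
    open IsTPartitionSystem T

    covering : ∀ u w → ∃ λ v → v ∈ N[_] G u × w ∈ P u v
    covering u = proj₂ (proj₂ (P0 u))

    blockOf : V → V → V
    blockOf u w = proj₁ (covering u w)

    blockOf∈N : ∀ u w → blockOf u w ∈ N[_] G u
    blockOf∈N u w = proj₁ (proj₂ (covering u w))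

    ∈blockOf : ∀ u w → w ∈ P u (blockOf u w)
    ∈blockOf u w = proj₂ (proj₂ (covering u w))

    inhabited⇒∈N : ExcludedMiddle 0ℓ → ∀ u v w → w ∈ P u v → v ∈ N[_] G u
    inhabited⇒∈N em u v w w∈P with em {v ∈ N[_] G u}
    ... | yes v∈N = v∈N
    ... | no  v∉N = ⊥-elim (from (P1c u v (λ e → v∉N (inj₁ (sym e))))
                                 (λ e → v∉N (inj₂ e)) w w∈P)

    -- Every element lies in exactly one block, so blockOf is characterised
    -- by membership: w ∈ V_{u,v} ⟺ blockOf u w = v.
    blockOf-unique : ExcludedMiddle 0ℓ → ∀ u v w → w ∈ P u v → blockOf u w ≡ v
    blockOf-unique em u v w w∈P =
      proj₁ (proj₂ (P0 u)) (blockOf u w) v w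
        (blockOf∈N u w) (inhabited⇒∈N em u v w w∈P) (∈blockOf u w) w∈P

    neighbour-block : ∀ u v → v ∈ N[_] G u → u ∈ P v u
    neighbour-block u v (inj₁ refl) = from (P1a u u) refl
    neighbour-block u v (inj₂ e)    = from (P1b v u (edge-distinct (E-sym e))) (E-sym e)

    two-way-block : ExcludedMiddle 0ℓ → ∀ u w x → w ∈ P u x → w ∈ P x u → u ≡ w
    two-way-block em u w x p q with inhabited⇒∈N em u x w p
    ... | inj₁ refl = sym (to (P1a u w) p)
    ... | inj₂ e    = ⊥-elim (P2 u x (edge-distinct e) w p q)

  -- The operation of a T-partition system is a travel groupoid on G.
  -- (t1): u * v is u or a neighbour of u, so u lies in its block V_{u*v,u}.
  -- (t2): (u * v) * v = u puts v in both V_{u,u*v} and V_{u*v,u}, so u = v.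
  -- Edges: by (P1b), uv is an edge iff v ∈ V_{u,v}, i.e. iff u * v = v.
  blockOf-isTravel : ExcludedMiddle 0ℓ → ∀ P (T : IsTPartitionSystem G P) →
                     IsTravelGroupoidOn G (PartitionOperation.blockOf P T)
  blockOf-isTravel em P T = record
    { t1 = λ u v → blockOf-unique em (u * v) u u (neighbour-block u (u * v) (blockOf∈N u v))
    ; t2 = λ u v e → two-way-block em u v (u * v) (∈blockOf u v)
                       (subst (λ y → v ∈ P (u * v) y) e (∈blockOf (u * v) v))
    ; on = λ u v → mk⇔ (edge⇒fields u v) (fields⇒edge u v)
    }
    where
      open IsTPartitionSystem T
      open PartitionOperation P T renaming (blockOf to _*_)

      edge⇒fields : ∀ u v → E u v → u ≢ v × (u * v ≡ v ⊎ v * u ≡ u)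
      edge⇒fields u v e =
        edge-distinct e , inj₁ (blockOf-unique em u v v (from (P1b u v (edge-distinct e)) e))

      fields⇒edge : ∀ u v → u ≢ v × (u * v ≡ v ⊎ v * u ≡ u) → E u v
      fields⇒edge u v (u≢v , inj₁ uv≡v) =
        to (P1b u v u≢v) (subst (λ y → v ∈ P u y) uv≡v (∈blockOf u v))
      fields⇒edge u v (u≢v , inj₂ vu≡u) =
        E-sym (to (P1b v u (λ e → u≢v (sym e))) (subst (λ y → u ∈ P v y) vu≡u (∈blockOf v u)))

  -- (R4) makes the operation smooth: if u * v = u * w then both v and w lie
  -- in V_{u, u*v}, and v * w is the block of w at v, so it lies there too.
  blockOf-smooth : ExcludedMiddle 0ℓ → ∀ P (T : IsTPartitionSystem G P) →
                   IsSmoothPartition G P → IsSmoothOp G (PartitionOperation.blockOf P T)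
  blockOf-smooth em P T R4 u v w uv≡uw =
    blockOf-unique em u (u * v) (v * w)
      (R4 u (u * v) w v (v * w) (subst (λ y → w ∈ P u y) (sym uv≡uw) (∈blockOf u w))
          (∈blockOf u v) (∈blockOf v w))
    where open PartitionOperation P T renaming (blockOf to _*_)

  module Correspondence (em : ExcludedMiddle 0ℓ) where
    module Groupoids  = Setoid (SmoothTravelGroupoidSetoid G)
    module Partitions = Setoid (SmoothTPartitionSystemSetoid G)

    toPartition : SmoothTravelGroupoid G → SmoothTPartitionSystem G
    toPartition A = record
      { P        = StepBlocks _*_
      ; isTPS    = stepBlocks-isTPS em _*_ isTravel
      ; smoothR4 = stepBlocks-smooth _*_ smooth
      }
      where open SmoothTravelGroupoid A

    toGroupoid : SmoothTPartitionSystem G → SmoothTravelGroupoid G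
    toGroupoid S = record
      { _*_      = PartitionOperation.blockOf P isTPS
      ; isTravel = blockOf-isTravel em P isTPS
      ; smooth   = blockOf-smooth em P isTPS smoothR4
      }
      where open SmoothTPartitionSystem S

    toPartition-cong : Congruent Groupoids._≈_ Partitions._≈_ toPartition
    toPartition-cong {A} {B} A≈B u v w = mk⇔ (trans (sym (A≈B u w))) (trans (A≈B u w))

    toGroupoid-cong : Congruent Partitions._≈_ Groupoids._≈_ toGroupoid
    toGroupoid-cong {S} {S'} S≈S' u w =
      sym (S'.blockOf-unique em u _ w (to (S≈S' u _ w) (S.∈blockOf u w)))
      where
        module S  = PartitionOperation (SmoothTPartitionSystem.P S)  (SmoothTPartitionSystem.isTPS S)
        module S' = PartitionOperation (SmoothTPartitionSystem.P S') (SmoothTPartitionSystem.isTPS S')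

    partition-roundtrip : ∀ S → toPartition (toGroupoid S) Partitions.≈ S
    partition-roundtrip S u v w =
      mk⇔ (λ e → subst (λ y → w ∈ P u y) e (∈blockOf u w)) (blockOf-unique em u v w)
      where
        open SmoothTPartitionSystem S
        open PartitionOperation P isTPS

    groupoid-roundtrip : ∀ A → toGroupoid (toPartition A) Groupoids.≈ A
    groupoid-roundtrip A u v = refl

    -- Setoid equality only sees operations and blocks, so
    -- the structures compared by a congruence are passed explicitly.
    inverseˡ : Inverseˡ Groupoids._≈_ Partitions._≈_ toPartition toGroupoid
    inverseˡ {S} {A} = strictlyInverseˡ⇒inverseˡ
      (SmoothTravelGroupoidSetoid G) (SmoothTPartitionSystemSetoid G)
      {f = toPartition} {f⁻¹ = toGroupoid}
      (λ {A} {B} → toPartition-cong {A} {B}) partition-roundtrip {S} {A}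

    inverseʳ : Inverseʳ Groupoids._≈_ Partitions._≈_ toPartition toGroupoid
    inverseʳ {A} {S} = strictlyInverseʳ⇒inverseʳ
      (SmoothTravelGroupoidSetoid G) (SmoothTPartitionSystemSetoid G)
      {f⁻¹ = toGroupoid} {f = toPartition}
      (λ {S} {S'} → toGroupoid-cong {S} {S'}) groupoid-roundtrip {A} {S}

theorem4p10 : ExcludedMiddle 0ℓ → (G : Graph) →
    Inverse (SmoothTravelGroupoidSetoid G) (SmoothTPartitionSystemSetoid G)
theorem4p10 em G = record
  { to        = toPartition
  ; from      = toGroupoid
  ; to-cong   = λ {A} {B} → toPartition-cong {A} {B}
  ; from-cong = λ {S} {S'} → toGroupoid-cong {S} {S'}
  ; inverse   = (λ {S} {A} → inverseˡ {S} {A}) , (λ {A} {S} → inverseʳ {A} {S})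
  }
  where open Correspondence G em
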